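{- Let $(L;\wedge,\vee,^{\Delta},^{\nabla},0,1)$ be a weakly dicomplemented lattice, $F(L)$ its set of filters, and for $F\in F(L)$ let $F^{\star}=\{a\in L\mid x^{\Delta}\le a\ \forall x\in F\}$ and $F^{+}=\{x\in L\mid x\vee a=1\ \forall a\in F\}$. (i) If the lattice $L$ is distributive and satisfies the condition ($\star$): for all $x,y\in L$, $x\vee y=1\Rightarrow x^{\Delta}\le y$, then $(F(L);\cap,\vee,^{\star},\{1\},L)$ is a pseudocomplemented lattice (i.e. for each $F\in F(L)$, $F^{\star}$ is the largest filter $G$ with $G\cap F=\{1\}$), it satisfies $F^{\star}=F^{+}$ for all $F\in F(L)$, and it is distributive. (ii) For all $F,G\in F(L)$, if $F\subseteq G$ then $G\cap(G\vee F^{\star})=G$.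
   Context: A weakly dicomplemented lattice (WDL) is an algebra $(L;\wedge,\vee,^{\Delta},^{\nabla},0,1)$ such that $(L;\wedge,\vee,0,1)$ is a bounded lattice and, for all $x,y\in L$: $x^{\Delta\Delta}\le x$; $x\le y\Rightarrow y^{\Delta}\le x^{\Delta}$; $(x\wedge y)\vee(x\wedge y^{\Delta})=x$; $x^{\nabla\nabla}\ge x$; $x\le y\Rightarrow y^{\nabla}\le x^{\nabla}$; $(x\vee y)\wedge(x\vee y^{\nabla})=x$. A filter of $L$ is a nonempty upward closed subset closed under $\wedge$. $F(L)$ is ordered by inclusion; $\cap$ is its meet and $\vee$ its join (smallest filter containing both). -}

module Defs where

open import Level using (Level; _⊔_; Lift) renaming (suc to lsuc)
open import Data.Unit.Polymorphic using (⊤)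
open import Data.Product using (_×_; ∃; ∃-syntax; _,_)
open import Algebra.Lattice.Bundles using (Lattice)
open import Algebra.Definitions using (_DistributesOver_)
open import Relation.Unary using (Pred; _⊆_; _≐_; _∩_)

record WDL c ℓ : Set (lsuc (c ⊔ ℓ)) where
  field
    lattice : Lattice c ℓ
  open Lattice lattice public

  infix 4 _≤_
  _≤_ : Carrier → Carrier → Set ℓ
  x ≤ y = x ≈ x ∧ y

  infix 8 _Δ _∇
  field
    𝟘 𝟙     : Carrier
    𝟘-least : ∀ x → 𝟘 ≤ x
    𝟙-great : ∀ x → x ≤ 𝟙
    _Δ _∇   : Carrier → Carrier
    ΔΔ≤     : ∀ x → (x Δ) Δ ≤ x
    Δ-anti  : ∀ {x y} → x ≤ y → y Δ ≤ x Δ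
    Δ-law   : ∀ x y → (x ∧ y) ∨ (x ∧ y Δ) ≈ x
    ≤∇∇     : ∀ x → x ≤ (x ∇) ∇
    ∇-anti  : ∀ {x y} → x ≤ y → y ∇ ≤ x ∇
    ∇-law   : ∀ x y → (x ∨ y) ∧ (x ∨ y ∇) ≈ x

module _ {c ℓ : Level} (W : WDL c ℓ) where
  open WDL W

  Subset : Set (c ⊔ lsuc ℓ ⊔ lsuc c)
  Subset = Pred Carrier (c ⊔ ℓ)

  record IsFilter (F : Subset) : Set (c ⊔ ℓ) where
    field
      nonempty : ∃[ x ] F x
      up-closed : ∀ {x y} → F x → x ≤ y → F y
      ∧-closed : ∀ {x y} → F x → F y → F (x ∧ y)

  one : Subset
  one x = Lift (c ⊔ ℓ) (x ≈ 𝟙)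

  whole : Subset
  whole _ = ⊤

  -- join of filters in F(L): the filter generated by F ∪ G,
  -- i.e. {x | ∃ f ∈ F, g ∈ G, f ∧ g ≤ x}
  infixr 6 _⊻_
  _⊻_ : Subset → Subset → Subset
  (F ⊻ G) x = ∃[ f ] ∃[ g ] (F f × G g × Lift c (f ∧ g ≤ x))

  _⋆ : Subset → Subset
  (F ⋆) a = ∀ x → F x → x Δ ≤ a

  _⁺ : Subset → Subset
  (F ⁺) x = ∀ a → F a → x ∨ a ≈ 𝟙

  StarCondition : Set (c ⊔ ℓ)
  StarCondition = ∀ x y → x ∨ y ≈ 𝟙 → x Δ ≤ y

  IsDistributive : Set (c ⊔ ℓ)
  IsDistributive = _DistributesOver_ _≈_ _∧_ _∨_

  FiltersBoundedLattice : Set (lsuc (c ⊔ ℓ))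
  FiltersBoundedLattice =
    IsFilter one × IsFilter whole
    × (∀ F → IsFilter F → one ⊆ F)
    × (∀ F G → IsFilter F → IsFilter G → IsFilter (F ∩ G))
    × (∀ F G → IsFilter F → IsFilter G →
         IsFilter (F ⊻ G) × F ⊆ (F ⊻ G) × G ⊆ (F ⊻ G)
         × (∀ H → IsFilter H → F ⊆ H → G ⊆ H → (F ⊻ G) ⊆ H))

  FiltersPseudocomplemented : Set (lsuc (c ⊔ ℓ))
  FiltersPseudocomplemented =
    ∀ F → IsFilter F →
      IsFilter (F ⋆) × ((F ⋆ ∩ F) ≐ one)
      × (∀ G → IsFilter G → (G ∩ F) ≐ one → G ⊆ F ⋆)

  FiltersDistributive : Set (lsuc (c ⊔ ℓ))
  FiltersDistributive =
    ∀ F G H → IsFilter F → IsFilter G → IsFilter H →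
      (F ∩ (G ⊻ H)) ≐ ((F ∩ G) ⊻ (F ∩ H))

{-# OPTIONS --safe #-}
-- Everything rests on x ∨ xΔ = 1 (the WDL axiom for Δ with x = 1): it gives
-- F⋆ ∩ F = {1} and F⋆ ⊆ F⁺ in every WDL. Condition (⋆) supplies the converses:
-- for g ∈ G and x ∈ F, the element x ∨ g lies in G ∩ F, so G ∩ F = {1} forces
-- x ∨ g = 1 and hence xΔ ≤ g. Distributivity passes from L to F(L): if g ∧ h ≤ x
-- with x ∈ F, g ∈ G, h ∈ H, then x ∨ g ∈ F ∩ G and x ∨ h ∈ F ∩ H meet to
-- x ∨ (g ∧ h) = x.
module Submission where

open import Defs
open import Data.Product using (_×_)
open import Relation.Unary using (_⊆_; _≐_; _∩_)

open import Level using (Level; lift; lower)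
open import Data.Product using (_,_; proj₁; proj₂)
open import Data.Unit.Polymorphic using (tt)
open import Algebra.Lattice.Properties.Lattice using (∨-∧-orderTheoreticLattice)
import Relation.Binary.Lattice as Order
import Relation.Binary.Lattice.Properties.MeetSemilattice as MeetSemilatticeProperties
import Relation.Binary.Lattice.Properties.DistributiveLattice as DistributiveLatticeProperties
import Relation.Binary.Reasoning.Setoid as SetoidReasoning

module FilterLattice {c ℓ : Level} (W : WDL c ℓ) where
  open WDL W

  orderLattice : Order.Lattice c ℓ ℓ
  orderLattice = ∨-∧-orderTheoreticLattice lattice

  open Order.Lattice orderLattice using (x≤x∨y; y≤x∨y; ∨-least; x∧y≤x; x∧y≤y; ∧-greatest; ≤-respˡ-≈)
    renaming (refl to ≤-refl; reflexive to ≤-reflexive; trans to ≤-trans; antisym to ≤-antisym)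
  open MeetSemilatticeProperties (Order.Lattice.meetSemilattice orderLattice) using (∧-monotonic)
  open SetoidReasoning setoid

  ∧-identityˡ : ∀ x → 𝟙 ∧ x ≈ x
  ∧-identityˡ x = trans (∧-comm 𝟙 x) (sym (𝟙-great x))

  𝟙≤⇒≈𝟙 : ∀ {x} → 𝟙 ≤ x → x ≈ 𝟙
  𝟙≤⇒≈𝟙 = ≤-antisym (𝟙-great _)

  x∨xΔ≈𝟙 : ∀ x → x ∨ x Δ ≈ 𝟙
  x∨xΔ≈𝟙 x = begin
    x ∨ x Δ              ≈⟨ ∨-cong (∧-identityˡ x) (∧-identityˡ (x Δ)) ⟨
    (𝟙 ∧ x) ∨ (𝟙 ∧ x Δ)  ≈⟨ Δ-law 𝟙 x ⟩
    𝟙                    ∎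

  Δ≤⇒∨≈𝟙 : ∀ {x a} → x Δ ≤ a → a ∨ x ≈ 𝟙
  Δ≤⇒∨≈𝟙 {x} {a} xΔ≤a = 𝟙≤⇒≈𝟙 (≤-respˡ-≈ (x∨xΔ≈𝟙 x)
    (∨-least (y≤x∨y a x) (≤-trans xΔ≤a (x≤x∨y a x))))

  Δ≤⇒≈𝟙 : ∀ {x} → x Δ ≤ x → x ≈ 𝟙
  Δ≤⇒≈𝟙 {x} xΔ≤x = 𝟙≤⇒≈𝟙 (≤-respˡ-≈ (x∨xΔ≈𝟙 x) (∨-least ≤-refl xΔ≤x))

  module Filter {F : Subset W} (isFilter : IsFilter W F) where
    open IsFilter isFilter public

    ∈-resp-≈ : ∀ {x y} → F x → x ≈ y → F y
    ∈-resp-≈ Fx x≈y = up-closed Fx (≤-reflexive x≈y)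

    𝟙∈ : F 𝟙
    𝟙∈ = up-closed (proj₂ nonempty) (𝟙-great _)

    ∨-closedˡ : ∀ {x y} → F x → F (x ∨ y)
    ∨-closedˡ Fx = up-closed Fx (x≤x∨y _ _)

    ∨-closedʳ : ∀ {x y} → F y → F (x ∨ y)
    ∨-closedʳ Fy = up-closed Fy (y≤x∨y _ _)

  open Filter using (𝟙∈; ∨-closedˡ; ∨-closedʳ)

  one-isFilter : IsFilter W (one W)
  one-isFilter = record
    { nonempty  = 𝟙 , lift refl
    ; up-closed = λ x≈𝟙 x≤y → lift (𝟙≤⇒≈𝟙 (≤-respˡ-≈ (lower x≈𝟙) x≤y))
    ; ∧-closed  = λ x≈𝟙 y≈𝟙 → lift (trans (∧-cong (lower x≈𝟙) (lower y≈𝟙)) (∧-identityˡ 𝟙))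
    }

  whole-isFilter : IsFilter W (whole W)
  whole-isFilter = record { nonempty = 𝟙 , tt ; up-closed = λ _ _ → tt ; ∧-closed = λ _ _ → tt }

  one⊆filter : ∀ F → IsFilter W F → one W ⊆ F
  one⊆filter F isFilter x≈𝟙 = Filter.∈-resp-≈ isFilter (𝟙∈ isFilter) (sym (lower x≈𝟙))

  ∩-isFilter : ∀ F G → IsFilter W F → IsFilter W G → IsFilter W (F ∩ G)
  ∩-isFilter F G isF isG = record
    { nonempty  = 𝟙 , 𝟙∈ isF , 𝟙∈ isG
    ; up-closed = λ (Fx , Gx) x≤y → F.up-closed Fx x≤y , G.up-closed Gx x≤y
    ; ∧-closed  = λ (Fx , Gx) (Fy , Gy) → F.∧-closed Fx Fy , G.∧-closed Gx Gy
    }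
    where
    module F = Filter isF
    module G = Filter isG

  module _ {F G : Subset W} (isF : IsFilter W F) (isG : IsFilter W G) where
    private
      module F = Filter isF
      module G = Filter isG

    ⊻-isFilter : IsFilter W (_⊻_ W F G)
    ⊻-isFilter = record
      { nonempty  = 𝟙 , 𝟙 , 𝟙 , F.𝟙∈ , G.𝟙∈ , lift (𝟙-great _)
      ; up-closed = λ (f , g , Ff , Gg , lift f∧g≤x) x≤y → f , g , Ff , Gg , lift (≤-trans f∧g≤x x≤y)
      ; ∧-closed  = λ (f , g , Ff , Gg , lift f∧g≤x) (f′ , g′ , Ff′ , Gg′ , lift f′∧g′≤y) →
          f ∧ f′ , g ∧ g′ , F.∧-closed Ff Ff′ , G.∧-closed Gg Gg′ , lift (∧-greatest
            (≤-trans (∧-monotonic (x∧y≤x f f′) (x∧y≤x g g′)) f∧g≤x)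
            (≤-trans (∧-monotonic (x∧y≤y f f′) (x∧y≤y g g′)) f′∧g′≤y))
      }

    ⊆-⊻ˡ : F ⊆ _⊻_ W F G
    ⊆-⊻ˡ {x} Fx = x , 𝟙 , Fx , G.𝟙∈ , lift (x∧y≤x x 𝟙)

    ⊆-⊻ʳ : G ⊆ _⊻_ W F G
    ⊆-⊻ʳ {x} Gx = 𝟙 , x , F.𝟙∈ , Gx , lift (x∧y≤y 𝟙 x)

  ⊻-least : ∀ {F G H} → IsFilter W H → F ⊆ H → G ⊆ H → _⊻_ W F G ⊆ H
  ⊻-least isH F⊆H G⊆H (f , g , Ff , Gg , lift f∧g≤x) =
    Filter.up-closed isH (Filter.∧-closed isH (F⊆H Ff) (G⊆H Gg)) f∧g≤x

  ∩-absorbs-⊻ : ∀ {G H} → IsFilter W G → IsFilter W H → (G ∩ _⊻_ W G H) ≐ G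
  ∩-absorbs-⊻ isG isH = proj₁ , λ Gx → Gx , ⊆-⊻ˡ isG isH Gx

  ⋆-isFilter : ∀ F → IsFilter W (_⋆ W F)
  ⋆-isFilter F = record
    { nonempty  = 𝟙 , λ _ _ → 𝟙-great _
    ; up-closed = λ Δ≤x x≤y a Fa → ≤-trans (Δ≤x a Fa) x≤y
    ; ∧-closed  = λ Δ≤x Δ≤y a Fa → ∧-greatest (Δ≤x a Fa) (Δ≤y a Fa)
    }

  ⋆∩≐one : ∀ {F} → IsFilter W F → (_⋆ W F ∩ F) ≐ one W
  ⋆∩≐one {F} isF =
      (λ {a} (Δ≤a , Fa) → lift (Δ≤⇒≈𝟙 (Δ≤a a Fa)))
    , λ a≈𝟙 → one⊆filter (_⋆ W F) (⋆-isFilter F) a≈𝟙 , one⊆filter F isF a≈𝟙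

  ⋆⊆⁺ : ∀ F → _⋆ W F ⊆ _⁺ W F
  ⋆⊆⁺ F Δ≤a x Fx = Δ≤⇒∨≈𝟙 (Δ≤a x Fx)

  module _ (star : StarCondition W) where

    ⁺⊆⋆ : ∀ F → _⁺ W F ⊆ _⋆ W F
    ⁺⊆⋆ F {a} a∨≈𝟙 x Fx = star x a (trans (∨-comm x a) (a∨≈𝟙 x Fx))

    ⋆-greatest : ∀ {F G} → IsFilter W F → IsFilter W G → (G ∩ F) ⊆ one W → G ⊆ _⋆ W F
    ⋆-greatest isF isG G∩F⊆one {g} Gg x Fx =
      star x g (lower (G∩F⊆one (∨-closedʳ isG Gg , ∨-closedˡ isF Fx)))

  module _ (distrib : IsDistributive W) where

    distributiveLattice : Order.DistributiveLattice c ℓ ℓ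
    distributiveLattice = record
      { isDistributiveLattice = record
        { isLattice    = Order.Lattice.isLattice orderLattice
        ; ∧-distribˡ-∨ = proj₁ distrib
        }
      }

    open DistributiveLatticeProperties distributiveLattice using (∨-distribˡ-∧)

    ∨-∧-∨-≤ : ∀ {x g h} → g ∧ h ≤ x → (x ∨ g) ∧ (x ∨ h) ≤ x
    ∨-∧-∨-≤ {x} {g} {h} g∧h≤x = ≤-respˡ-≈ (∨-distribˡ-∧ x g h) (∨-least ≤-refl g∧h≤x)

    ∩-distribˡ-⊻-⊆ : ∀ {F G H} → IsFilter W F → IsFilter W G → IsFilter W H →
                     (F ∩ _⊻_ W G H) ⊆ _⊻_ W (F ∩ G) (F ∩ H)
    ∩-distribˡ-⊻-⊆ isF isG isH {x} (Fx , g , h , Gg , Hh , lift g∧h≤x) =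
        x ∨ g , x ∨ h
      , (∨-closedˡ isF Fx , ∨-closedʳ isG Gg)
      , (∨-closedˡ isF Fx , ∨-closedʳ isH Hh)
      , lift (∨-∧-∨-≤ g∧h≤x)

  ∩-distribˡ-⊻-⊇ : ∀ {F G H} → IsFilter W F → IsFilter W G → IsFilter W H →
                   _⊻_ W (F ∩ G) (F ∩ H) ⊆ (F ∩ _⊻_ W G H)
  ∩-distribˡ-⊻-⊇ {F} {G} {H} isF isG isH =
    ⊻-least (∩-isFilter F (_⊻_ W G H) isF (⊻-isFilter isG isH))
      (λ (Fx , Gx) → Fx , ⊆-⊻ˡ isG isH Gx)
      (λ (Fx , Hx) → Fx , ⊆-⊻ʳ isG isH Hx)

corollary3p4 : ∀ {c ℓ} (W : WDL c ℓ) →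
    (IsDistributive W → StarCondition W →
      FiltersBoundedLattice W × FiltersPseudocomplemented W
      × (∀ F → IsFilter W F → _⋆ W F ≐ _⁺ W F)
      × FiltersDistributive W)
    × (∀ F G → IsFilter W F → IsFilter W G → F ⊆ G →
        (G ∩ _⊻_ W G (_⋆ W F)) ≐ G)
corollary3p4 W =
    (λ distrib star →
        ( one-isFilter , whole-isFilter , one⊆filter , ∩-isFilter
        , λ F G isF isG → ⊻-isFilter isF isG , ⊆-⊻ˡ isF isG , ⊆-⊻ʳ isF isG , λ H isH → ⊻-least isH )
      , (λ F isF → ⋆-isFilter F , ⋆∩≐one isF , λ G isG G∩F≐one → ⋆-greatest star isF isG (proj₁ G∩F≐one))
      , (λ F _ → ⋆⊆⁺ F , ⁺⊆⋆ star F)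
      , λ F G H isF isG isH → ∩-distribˡ-⊻-⊆ distrib isF isG isH , ∩-distribˡ-⊻-⊇ isF isG isH)
  , λ F G _ isG _ → ∩-absorbs-⊻ isG (⋆-isFilter F)
  where open FilterLattice W
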